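{- Let $(X,\Sigma)$ be an acyclic implicational base, $x\in X$, and let $M,M^*$ be two distinct sets in $\mathrm{irr}(x)$. Then there exist $y\in M^*\setminus M$, a minimal transversal $T$ of $\mathcal{H}_{M,y}$, and an irreducible selection $\mathcal{S}\in\mathcal{S}(T)$ such that $M^*\subseteq\bigcap\mathcal{S}$.
   Context: An implicational base $(X,\Sigma)$ is a set of implications $A\to B$ with $A,B\subseteq X$ disjoint; its closed sets are the $C\subseteq X$ with $A\subseteq C\Rightarrow B\subseteq C$ for all $A\to B\in\Sigma$. It is acyclic if the digraph on $X$ with arcs $ab$ ($a\in A,b\in B$, $A\to B\in\Sigma$) is acyclic. For $z\in X$, $\mathrm{irr}(z)$ is the family of inclusion-maximal closed sets not containing $z$. For $M\in\mathrm{irr}(x)$ and $y\in X\setminus M$, $\mathcal{H}_{M,y}$ is the hypergraph with edge set $\mathcal{E}_{M,y}=\{A: A\to B\in\Sigma,\ A\setminus M=\{y\},\ B\not\subseteq M\}$ on vertex set $\bigcup\mathcal{E}_{M,y}$; a minimal transversal is an inclusion-minimal vertex set meeting every edge. For $T\subseteq X$, an irreducible selection for $T$ is a family obtained by choosing one set $M_t\in\mathrm{irr}(t)$ for each $t\in T$; $\mathcal{S}(T)$ is the set of all such families. The intersection of the empty family is taken to be $X$. -}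

module Defs where

open import Data.Nat using (ℕ)
open import Data.Fin using (Fin)
open import Data.Fin.Subset using (Subset; _∈_; _∉_; _⊆_)
open import Data.List using (List)
open import Data.List.Membership.Propositional using () renaming (_∈_ to _∈ₗ_)
open import Data.Product using (Σ; ∃; _×_; _,_; proj₁; proj₂)
open import Relation.Binary.PropositionalEquality using (_≡_)
open import Relation.Binary.Construct.Closure.Transitive using (TransClosure)
open import Relation.Nullary using (¬_)

Implication : ℕ → Set
Implication n = Subset n × Subset n

record ImplBase (n : ℕ) : Set where
  field
    imps     : List (Implication n)
    disjoint : ∀ {A B} → (A , B) ∈ₗ imps → ∀ z → z ∈ A → z ∉ B
open ImplBase public

module _ {n : ℕ} (Σb : ImplBase n) where

  Closed : Subset n → Set
  Closed C = ∀ {A B} → (A , B) ∈ₗ imps Σb → A ⊆ C → B ⊆ C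

  Arc : Fin n → Fin n → Set
  Arc a b = ∃ λ (AB : Implication n) → AB ∈ₗ imps Σb × (a ∈ proj₁ AB) × (b ∈ proj₂ AB)

  Acyclic : Set
  Acyclic = ∀ a → ¬ TransClosure Arc a a

  Irr : Fin n → Subset n → Set
  Irr z M = Closed M × z ∉ M × (∀ C → Closed C → z ∉ C → M ⊆ C → C ⊆ M)

  DiffIsSingleton : Subset n → Subset n → Fin n → Set
  DiffIsSingleton A M y = (y ∈ A × y ∉ M) × (∀ z → z ∈ A → z ∉ M → z ≡ y)

  Edge : Subset n → Fin n → Subset n → Set
  Edge M y E = ∃ λ B → (E , B) ∈ₗ imps Σb × DiffIsSingleton E M y × ¬ (B ⊆ M)

  Vertex : Subset n → Fin n → Fin n → Set
  Vertex M y v = ∃ λ E → Edge M y E × v ∈ E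

  Transversal : Subset n → Fin n → Subset n → Set
  Transversal M y T = (∀ v → v ∈ T → Vertex M y v)
                    × (∀ E → Edge M y E → ∃ λ v → v ∈ T × v ∈ E)

  MinimalTransversal : Subset n → Fin n → Subset n → Set
  MinimalTransversal M y T =
    Transversal M y T × (∀ T′ → T′ ⊆ T → Transversal M y T′ → T ⊆ T′)

  IrrSelection : Subset n → (Fin n → Subset n) → Set
  IrrSelection T S = ∀ t → t ∈ T → Irr t (S t)

  -- z ∈ ⋂ S  (intersection over t ∈ T; equals X when T is empty)
  InBigCap : Subset n → (Fin n → Subset n) → Fin n → Set
  InBigCap T S z = ∀ t → t ∈ T → z ∈ S t

-- In the difference M* ∖ M, which is nonempty because distinct members of irr(x) are
-- incomparable, acyclicity yields an element y with no arc into M* ∖ M. Every edge E of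
-- H_{M,y} comes from some E → B with y ∈ E and B ⊈ M; were E ⊆ M*, closedness would give
-- B ⊆ M*, hence an arc from y to some b ∈ B ∩ (M* ∖ M). So every edge leaves M*, the
-- vertices outside M* form a transversal, and a minimal transversal T below it avoids M*.
-- Each t ∈ T lies outside the closed set M*, which therefore extends to some M_t ∈ irr(t).
module Submission where

open import Defs
open import Data.Nat using (ℕ)
open import Data.Fin using (Fin)
open import Data.Fin.Subset using (Subset; _∈_; _∉_)
open import Data.Product using (∃; _×_)
open import Relation.Binary.PropositionalEquality using (_≡_)
open import Relation.Nullary using (¬_)

open import Level using (Level)
open import Function using (_∘_; id; Equivalence)
open import Data.Bool.Properties using (T-≡)
open import Data.Nat using (zero; suc; s≤s; z≤n)
open import Data.Nat.Properties using (n<1+n)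
open import Data.Fin as Fin using (_≟_)
open import Data.Fin.Properties using (any?; all?; pigeonhole)
open import Data.Fin.Subset using (_⊆_; _⊈_; _⊂_; _⊄_; _⊃_)
open import Data.Fin.Subset.Properties using (_∈?_; _⊆?_; _⊂?_; ⊆-antisym; ⊆-trans; anySubset?)
open import Data.Fin.Subset.Induction using (Acc; acc; ⊂-wellFounded; ⊃-wellFounded)
open import Data.Vec using (Vec; []; _∷_; lookup; tabulate)
open import Data.Vec.Properties using (lookup∘tabulate; lookup⇒[]=; []=⇒lookup)
open import Data.List using (List)
open import Data.List.Membership.Propositional using (find; lose) renaming (_∈_ to _∈ₗ_)
open import Data.List.Relation.Unary.All as All using ()
open import Data.List.Relation.Unary.Any as Any using ()
open import Data.Product using (_,_; proj₁; proj₂)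
open import Data.Sum using (_⊎_; inj₁; inj₂)
open import Data.Empty using (⊥-elim)
open import Relation.Nullary using (Dec; yes; no; isYes)
open import Relation.Nullary.Decidable using (¬?; _×-dec_; _→-dec_; map′; toWitness; fromWitness; decidable-stable)
open import Relation.Unary using (Pred; Decidable)
open import Relation.Binary using (Rel)
open import Relation.Binary.PropositionalEquality using (sym; trans; subst)
open import Relation.Binary.Construct.Closure.Transitive using (TransClosure; [_]; _∷ʳ_)

private
  variable
    ℓ ℓ′ : Level
    n : ℕ

module _ {p q : Subset n} where

  ⊈⇒∃∉ : p ⊈ q → ∃ λ x → x ∈ p × x ∉ q
  ⊈⇒∃∉ p⊈q with any? (λ x → (x ∈? p) ×-dec ¬? (x ∈? q))
  ... | yes witness = witness
  ... | no ∄ = ⊥-elim (p⊈q λ {x} x∈p → decidable-stable (x ∈? q) (λ x∉q → ∄ (x , x∈p , x∉q)))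

  p⊆q∧p⊄q⇒q⊆p : p ⊆ q → p ⊄ q → q ⊆ p
  p⊆q∧p⊄q⇒q⊆p p⊆q p⊄q {x} x∈q = decidable-stable (x ∈? p) (λ x∉p → p⊄q (p⊆q , x , x∈q , x∉p))

module _ {P : Pred (Fin n) ℓ} (P? : Decidable P) where

  select : Subset n
  select = tabulate (isYes ∘ P?)

  ∈-select⁺ : ∀ {x} → P x → x ∈ select
  ∈-select⁺ {x} px =
    lookup⇒[]= x select (trans (lookup∘tabulate _ x) (Equivalence.to T-≡ (fromWitness px)))

  ∈-select⁻ : ∀ {x} → x ∈ select → P x
  ∈-select⁻ {x} x∈ =
    toWitness (Equivalence.from T-≡ (trans (sym (lookup∘tabulate _ x)) ([]=⇒lookup x∈)))

module _ {P : Pred (Subset n) ℓ} (P? : Decidable P) where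

  ∃-minimal-⊆ : ∀ {U} → P U → ∃ λ T → T ⊆ U × P T × (∀ T′ → T′ ⊆ T → P T′ → T ⊆ T′)
  ∃-minimal-⊆ {U} = go (⊂-wellFounded U)
    where
    go : ∀ {U} → Acc _⊂_ U → P U → ∃ λ T → T ⊆ U × P T × (∀ T′ → T′ ⊆ T → P T′ → T ⊆ T′)
    go {U} (acc below) pU with anySubset? (λ T′ → (T′ ⊂? U) ×-dec P? T′)
    ... | yes (T′ , T′⊂U , pT′) =
      let T , T⊆T′ , pT , minimal = go (below T′⊂U) pT′
      in  T , ⊆-trans T⊆T′ (proj₁ T′⊂U) , pT , minimal
    ... | no ∄ = U , id , pU , λ T′ T′⊆U pT′ → p⊆q∧p⊄q⇒q⊆p T′⊆U (λ T′⊂U → ∄ (T′ , T′⊂U , pT′))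

  ∃-maximal-⊇ : ∀ {C} → P C → ∃ λ S → C ⊆ S × P S × (∀ S′ → S ⊆ S′ → P S′ → S′ ⊆ S)
  ∃-maximal-⊇ {C} = go (⊃-wellFounded C)
    where
    go : ∀ {C} → Acc _⊃_ C → P C → ∃ λ S → C ⊆ S × P S × (∀ S′ → S ⊆ S′ → P S′ → S′ ⊆ S)
    go {C} (acc above) pC with anySubset? (λ S′ → (C ⊂? S′) ×-dec P? S′)
    ... | yes (S′ , C⊂S′ , pS′) =
      let S , S′⊆S , pS , maximal = go (above C⊂S′) pS′
      in  S , ⊆-trans (proj₁ C⊂S′) S′⊆S , pS , maximal
    ... | no ∄ = C , id , pC , λ S′ C⊆S′ pS′ → p⊆q∧p⊄q⇒q⊆p C⊆S′ (λ C⊂S′ → ∄ (S′ , C⊂S′ , pS′))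

module _ {R : Rel (Fin n) ℓ} (R? : ∀ a b → Dec (R a b)) (R-acyclic : ∀ a → ¬ TransClosure R a a)
         {P : Pred (Fin n) ℓ′} (P? : Decidable P) where

  private
    Sink : Set _
    Sink = ∃ λ y → P y × ¬ ∃ λ b → P b × R y b

    -- Index zero is the last vertex; earlier vertices reach later ones.
    Walk : ℕ → Set _
    Walk k = ∃ λ (v : Vec (Fin n) (suc k)) → P (lookup v Fin.zero)
               × (∀ {i j} → j Fin.< i → TransClosure R (lookup v i) (lookup v j))

    sink-or-walk : ∀ k → ∃ P → Sink ⊎ Walk k
    sink-or-walk zero (a , pa) = inj₂ (a ∷ [] , pa , λ { {Fin.zero} () })
    sink-or-walk (suc k) start with sink-or-walk k start
    ... | inj₁ sink = inj₁ sink
    ... | inj₂ (v , pv , reach) with any? (λ b → P? b ×-dec R? (lookup v Fin.zero) b)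
    ...   | no ¬step = inj₁ (lookup v Fin.zero , pv , ¬step)
    ...   | yes (b , pb , r) = inj₂ (b ∷ v , pb , reach′)
      where
      reach′ : ∀ {i j} → j Fin.< i → TransClosure R (lookup (b ∷ v) i) (lookup (b ∷ v) j)
      reach′ {Fin.suc Fin.zero}    {Fin.zero}  _         = [ r ]
      reach′ {Fin.suc (Fin.suc i)} {Fin.zero}  _         = reach {Fin.suc i} {Fin.zero} (s≤s z≤n) ∷ʳ r
      reach′ {Fin.suc i}           {Fin.suc j} (s≤s j<i) = reach j<i

  -- A walk with n + 1 vertices in Fin n repeats a vertex, closing a cycle.
  ∃-sink : ∃ P → ∃ λ y → P y × ¬ ∃ λ b → P b × R y b
  ∃-sink start with sink-or-walk n start
  ... | inj₁ sink = sink
  ... | inj₂ (v , _ , reach) with pigeonhole (n<1+n n) (lookup v)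
  ...   | i , j , i<j , vᵢ≡vⱼ =
    ⊥-elim (R-acyclic (lookup v i) (subst (λ a → TransClosure R a (lookup v i)) (sym vᵢ≡vⱼ) (reach i<j)))

module _ {A : Set} {Q : Pred A ℓ} (Q? : Decidable Q) (xs : List A) where

  ∀-∈? : Dec (∀ {x} → x ∈ₗ xs → Q x)
  ∀-∈? = map′ All.lookup All.tabulate (All.all? Q? xs)

  ∃-∈? : Dec (∃ λ x → x ∈ₗ xs × Q x)
  ∃-∈? = map′ find (λ (x , x∈ , qx) → lose x∈ qx) (Any.any? Q? xs)

module _ (Σb : ImplBase n) where

  closed? : Decidable (Closed Σb)
  closed? C = map′ (λ closed {A} {B} → closed {A , B}) (λ closed {(A , B)} → closed)
    (∀-∈? {Q = λ (A , B) → A ⊆ C → B ⊆ C} (λ (A , B) → (A ⊆? C) →-dec (B ⊆? C)) (imps Σb))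

  arc? : ∀ a b → Dec (Arc Σb a b)
  arc? a b = ∃-∈? (λ (A , B) → (a ∈? A) ×-dec (b ∈? B)) (imps Σb)

  module _ (M : Subset n) (y : Fin n) where

    EdgeImplication : Implication n → Set
    EdgeImplication (A , B) = DiffIsSingleton Σb A M y × B ⊈ M

    edgeImplication? : Decidable EdgeImplication
    edgeImplication? (A , B) =
      (((y ∈? A) ×-dec ¬? (y ∈? M)) ×-dec all? (λ z → (z ∈? A) →-dec ¬? (z ∈? M) →-dec (z ≟ y)))
      ×-dec ¬? (B ⊆? M)

    vertex? : Decidable (Vertex Σb M y)
    vertex? v = map′ (λ ((E , B) , m , e , v∈E) → E , (B , m , e) , v∈E)
                     (λ (E , (B , m , e) , v∈E) → (E , B) , m , e , v∈E)
      (∃-∈? (λ (A , B) → edgeImplication? (A , B) ×-dec (v ∈? A)) (imps Σb))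

    transversal? : Decidable (Transversal Σb M y)
    transversal? T = all? (λ v → (v ∈? T) →-dec vertex? v) ×-dec meetsEdges?
      where
      meetsEdges? : Dec (∀ E → Edge Σb M y E → ∃ λ v → v ∈ T × v ∈ E)
      meetsEdges? = map′ (λ meets E (B , m , e) → meets m e)
                         (λ meets {(E , B)} m e → meets E (B , m , e))
        (∀-∈? (λ (A , B) → edgeImplication? (A , B) →-dec any? (λ v → (v ∈? T) ×-dec (v ∈? A))) (imps Σb))

module _ (Σb : ImplBase n) where

  irr-⊆⇒≡ : ∀ {x M N} → Irr Σb x M → Irr Σb x N → N ⊆ M → M ≡ N
  irr-⊆⇒≡ (closedM , x∉M , _) (_ , _ , maximalN) N⊆M = ⊆-antisym (maximalN _ closedM x∉M N⊆M) N⊆M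

  closed⇒∃-irr-⊇ : ∀ {C t} → Closed Σb C → t ∉ C → ∃ λ S → C ⊆ S × Irr Σb t S
  closed⇒∃-irr-⊇ {C} {t} closedC t∉C =
    let S , C⊆S , (closedS , t∉S) , maximal =
          ∃-maximal-⊇ (λ S → closed? Σb S ×-dec ¬? (t ∈? S)) (closedC , t∉C)
    in  S , C⊆S , closedS , t∉S , λ C′ closedC′ t∉C′ S⊆C′ → maximal C′ S⊆C′ (closedC′ , t∉C′)

  sink⇒edges⊈ : ∀ {M N y} → Closed Σb N
    → ¬ (∃ λ b → (b ∈ N × b ∉ M) × Arc Σb y b) → ∀ E → Edge Σb M y E → E ⊈ N
  sink⇒edges⊈ closedN y-sink _ (B , AB∈ , ((y∈E , _) , _) , B⊈M) E⊆N =
    let b , b∈B , b∉M = ⊈⇒∃∉ B⊈M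
    in  y-sink (b , (closedN AB∈ E⊆N b∈B , b∉M) , (_ , B) , AB∈ , y∈E , b∈B)

  ∃-minimalTransversal-avoiding : ∀ {M y N} → (∀ E → Edge Σb M y E → E ⊈ N)
    → ∃ λ T → MinimalTransversal Σb M y T × (∀ t → t ∈ T → t ∉ N)
  ∃-minimalTransversal-avoiding {M} {y} {N} edges⊈N =
    let T , T⊆U , transversal , minimal = ∃-minimal-⊆ (transversal? Σb M y) U-transversal
    in  T , (transversal , minimal) , λ t t∈T → proj₁ (∈-select⁻ _ (T⊆U t∈T))
    where
    U : Subset n
    U = select (λ v → ¬? (v ∈? N) ×-dec vertex? Σb M y v)

    U-transversal : Transversal Σb M y U
    U-transversal = (λ v v∈U → proj₂ (∈-select⁻ _ v∈U))
                  , λ E edge → let v , v∈E , v∉N = ⊈⇒∃∉ (edges⊈N E edge)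
                               in  v , ∈-select⁺ _ (v∉N , E , edge , v∈E) , v∈E

  ∃-irrSelection-⊇ : ∀ {C} T → Closed Σb C → (∀ t → t ∈ T → t ∉ C)
    → ∃ λ S → IrrSelection Σb T S × (∀ z → z ∈ C → InBigCap Σb T S z)
  ∃-irrSelection-⊇ {C} T closedC T-avoids-C =
    (λ t → choose t (t ∈? C))
    , (λ t t∈T → proj₂ (choose-⊇-irr t (t ∈? C) (T-avoids-C t t∈T)))
    , λ z z∈C t t∈T → proj₁ (choose-⊇-irr t (t ∈? C) (T-avoids-C t t∈T)) z∈C
    where
    -- The choice for t ∈ C is junk; such t are not in T.
    choose : ∀ t → Dec (t ∈ C) → Subset n
    choose t (yes _)  = C
    choose t (no t∉C) = proj₁ (closed⇒∃-irr-⊇ closedC t∉C)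

    choose-⊇-irr : ∀ t (t∈?C : Dec (t ∈ C)) → t ∉ C → C ⊆ choose t t∈?C × Irr Σb t (choose t t∈?C)
    choose-⊇-irr t (yes t∈C) t∉C = ⊥-elim (t∉C t∈C)
    choose-⊇-irr t (no t∉C)  _   = proj₂ (closed⇒∃-irr-⊇ closedC t∉C)

lemma29 : ∀ {n} (Σb : ImplBase n) → Acyclic Σb → (x : Fin n) (M M* : Subset n)
          → Irr Σb x M → Irr Σb x M* → ¬ (M ≡ M*)
          → ∃ λ (y : Fin n) → (y ∈ M* × y ∉ M)
            × ∃ λ (T : Subset n) → MinimalTransversal Σb M y T
            × ∃ λ (S : Fin n → Subset n) → IrrSelection Σb T S
            × (∀ z → z ∈ M* → InBigCap Σb T S z)
lemma29 Σb acyclic x M M* irrM irrM* M≢M* =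
  let y , y∈M*∖M , y-sink = ∃-sink (arc? Σb) acyclic {P = λ v → v ∈ M* × v ∉ M}
                                   (λ v → (v ∈? M*) ×-dec ¬? (v ∈? M))
                                   (⊈⇒∃∉ (λ M*⊆M → M≢M* (irr-⊆⇒≡ Σb irrM irrM* M*⊆M)))
      T , T-minimal , T-avoids-M* = ∃-minimalTransversal-avoiding Σb (sink⇒edges⊈ Σb closedM* y-sink)
      S , S-irr , M*⊆⋂S = ∃-irrSelection-⊇ Σb T closedM* T-avoids-M*
  in  y , y∈M*∖M , T , T-minimal , S , S-irr , M*⊆⋂S
  where closedM* = proj₁ irrM*
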